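{- Let $(\Sigma,<)$ be a finite totally ordered alphabet and let $\ell_1,\ldots,\ell_h$ be anti-Lyndon words with $\ell_1\ge_p\ell_2\ge_p\cdots\ge_p\ell_h$. Let $h\ge2$ and let $i$, $1\le i<h$, be such that $\ell_1=\ell_2=\cdots=\ell_i\neq\ell_{i+1}$. If there is $j$, $i<j\le h$, such that $\ell_{i+1}\cdots\ell_j$ is a prefix of $\ell_1$, then $|\ell_1|>|\ell_{i+1}\cdots\ell_j|$.
   Context: $x\ge_p y$ means $y$ is a prefix of $x$; $|x|$ is the length of $x$. Inverse order $<_{in}$ on $\Sigma$: $b<_{in}a\iff a<b$; $\prec_{in}$ the lexicographic order on $\Sigma^*$ induced by $<_{in}$ ($x\prec_{in}y$ if $x$ is a proper prefix of $y$, or $x=ras$, $y=rbt$ with $a<_{in}b$). An anti-Lyndon word is a nonempty primitive word strictly smaller for $\prec_{in}$ than all its other conjugates. -}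

module Defs where

open import Level using (Level)
open import Data.Nat using (ℕ; zero; suc; _∸_; _≥_)
open import Data.Fin using (Fin)
open import Data.List using (List; []; _∷_; _++_; length; take; drop; concat; replicate)
open import Data.Product using (Σ; ∃; ∃-syntax; _×_; _,_)
open import Data.Sum using (_⊎_)
open import Relation.Nullary using (¬_)
open import Relation.Binary.PropositionalEquality using (_≡_; _≢_)
open import Relation.Binary.Bundles using (StrictTotalOrder)
open import Function.Bundles using (_↔_)

module Words {c ℓ₁ ℓ₂ : Level} (Σ' : StrictTotalOrder c ℓ₁ ℓ₂) where
  open StrictTotalOrder Σ' using () renaming (Carrier to A; _<_ to _<ₐ_)

  Word : Set c
  Word = List A

  _≥p_ : Word → Word → Set c
  x ≥p y = ∃[ z ] (y ++ z ≡ x)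

  _<in_ : A → A → Set ℓ₂
  b <in a = a <ₐ b

  _≺in_ : Word → Word → Set (c Level.⊔ ℓ₂)
  x ≺in y =
    (∃[ z ] ((z ≢ []) × (x ++ z ≡ y)))
    ⊎ (∃[ r ] ∃[ a ] ∃[ s ] ∃[ b ] ∃[ t ]
         ((x ≡ r ++ (a ∷ s)) × (y ≡ r ++ (b ∷ t)) × (a <in b)))

  rot : ℕ → Word → Word
  rot k w = drop k w ++ take k w

  IsConjugate : Word → Word → Set c
  IsConjugate v w = ∃[ p ] ∃[ q ] ((w ≡ p ++ q) × (v ≡ q ++ p))

  Primitive : Word → Set c
  Primitive w = ¬ (∃[ u ] ∃[ n ] ((n ≥ 2) × (w ≡ concat (replicate n u))))

  AntiLyndon : Word → Set (c Level.⊔ ℓ₂)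
  AntiLyndon w =
    (w ≢ []) × Primitive w ×
    (∀ v → IsConjugate v w → v ≢ w → w ≺in v)

  prodFrom : (ℕ → Word) → ℕ → ℕ → Word
  prodFrom l i zero = []
  prodFrom l i (suc k) = l (suc i) ++ prodFrom l (suc i) k

  -- ℓ_{i+1} ⋯ ℓ_j  (empty if j ≤ i)
  prodW : (ℕ → Word) → ℕ → ℕ → Word
  prodW l i j = prodFrom l i (j ∸ i)

Finite : ∀ {a} → Set a → Set a
Finite A = ∃[ n ] (A ↔ Fin n)

-- If ℓ_{i+1}⋯ℓ_j were all of ℓ₁, then either j = i + 1 and ℓ_{i+1} = ℓ₁ = ℓ_i, or ℓ_j is a
-- proper suffix of ℓ₁ that is also, through the chain ℓ_i ≥p ⋯ ≥p ℓ_j, a prefix of ℓ₁.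
-- But anti-Lyndon words are unbordered: if w = pb = bt with p, b nonempty, comparing w with
-- its conjugates bp and tb gives t ≺in p and p ≼in t (p and t have the same length), unless
-- p = t; then pb = bp, and by Lyndon–Schützenberger w is a proper power.
module Submission where

open import Defs
open import Level using (Level)
open import Data.Nat using (ℕ; zero; suc; _+_; _∸_; _≤_; _<_; _≤′_; ≤′-refl; ≤′-step; z≤n; s≤s)
open import Data.Nat.Properties
  using (suc-injective; ≤-refl; ≤-trans; ≤-total; <⇒≤; ≤⇒≤′; ≤′⇒≤; +-comm; +-suc; +-cancelˡ-≡; +-mono-≤; m<m+n; m<n⇒0<n∸m; m+[n∸m]≡n)
open import Data.Nat.Induction using (<-wellFounded)
open import Induction.WellFounded using (Acc; acc)
open import Data.List using (List; []; _∷_; _++_; length; concat; replicate)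
open import Data.List.Properties
  using (++-assoc; ++-identityʳ; ++-cancelˡ; ++-cancelʳ; ++-conicalˡ; ++-conicalʳ; ∷-injective; length-++; length-++-≤ʳ)
open import Data.Product using (_×_; _,_; proj₁; ∃-syntax)
open import Data.Sum using (_⊎_; inj₁; inj₂; [_,_])
open import Data.Empty using (⊥-elim)
open import Relation.Nullary using (¬_)
open import Relation.Binary.PropositionalEquality
  using (_≡_; _≢_; refl; sym; trans; cong; cong₂; subst; module ≡-Reasoning)
open import Relation.Binary.Bundles using (StrictTotalOrder)

module _ {a} {A : Set a} where

  _^_ : List A → ℕ → List A
  u ^ n = concat (replicate n u)

  ^-+ : ∀ u m n → u ^ (m + n) ≡ u ^ m ++ u ^ n
  ^-+ u zero    n = refl
  ^-+ u (suc m) n = trans (cong (u ++_) (^-+ u m n)) (sym (++-assoc u (u ^ m) (u ^ n)))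

  CommonRoot : List A → List A → Set a
  CommonRoot x y = ∃[ z ] ∃[ m ] ∃[ n ] (x ≡ z ^ m × y ≡ z ^ n)

  commonRoot-sym : ∀ {x y} → CommonRoot x y → CommonRoot y x
  commonRoot-sym (z , m , n , x≡zᵐ , y≡zⁿ) = z , n , m , y≡zⁿ , x≡zᵐ

  commonRoot-++ : ∀ {x w} → CommonRoot x w → CommonRoot x (x ++ w)
  commonRoot-++ (z , m , n , refl , refl) = z , m , m + n , refl , sym (^-+ z m n)

  ++-≡-prefix : ∀ x y {u v : List A} → x ++ u ≡ y ++ v → length x ≤ length y → ∃[ w ] (y ≡ x ++ w)
  ++-≡-prefix []      y       _  _         = y , refl
  ++-≡-prefix (c ∷ x) (d ∷ y) eq (s≤s x≤y) with ∷-injective eq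
  ... | refl , eq′ = let w , y≡xw = ++-≡-prefix x y eq′ x≤y in w , cong (c ∷_) y≡xw

  commute-prefix : ∀ {x y} → length x ≤ length y → x ++ y ≡ y ++ x →
                   ∃[ w ] (y ≡ x ++ w × x ++ w ≡ w ++ x)
  commute-prefix {x} {y} x≤y xy≡yx with ++-≡-prefix x y xy≡yx x≤y
  ... | w , refl = w , refl , ++-cancelˡ x (x ++ w) (w ++ x) (trans xy≡yx (++-assoc x w x))

  length-<-∷-++ : ∀ (c : A) x w → length w < length ((c ∷ x) ++ w)
  length-<-∷-++ _ x w = s≤s (length-++-≤ʳ w {x})

  commonRoot-acc : ∀ x y → Acc _<_ (length (x ++ y)) → x ++ y ≡ y ++ x → CommonRoot x y
  commonRoot-acc []       y  _ _ = y , 0 , 1 , refl , sym (++-identityʳ y)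
  commonRoot-acc x        [] _ _ = x , 1 , 0 , sym (++-identityʳ x) , refl
  commonRoot-acc x@(c ∷ x′) y@(_ ∷ y′) (acc rs) xy≡yx with ≤-total (length x) (length y)
  ... | inj₁ x≤y with commute-prefix x≤y xy≡yx
  ...   | w , refl , xw≡wx =
          commonRoot-++ (commonRoot-acc x w (rs (length-<-∷-++ c x′ (x ++ w))) xw≡wx)
  commonRoot-acc x@(_ ∷ _) y@(d ∷ y′) (acc rs) xy≡yx | inj₂ y≤x with commute-prefix y≤x (sym xy≡yx)
  ...   | w , refl , yw≡wy =
          commonRoot-sym (commonRoot-++ (commonRoot-acc y w
            (rs (subst (λ v → length (y ++ w) < length v) (sym xy≡yx) (length-<-∷-++ d y′ (y ++ w))))
            yw≡wy))

  commute⇒commonRoot : ∀ {x y} → x ++ y ≡ y ++ x → CommonRoot x y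
  commute⇒commonRoot {x} {y} = commonRoot-acc x y (<-wellFounded _)

module AntiLyndonWords {c ℓ₁ ℓ₂ : Level} (S : StrictTotalOrder c ℓ₁ ℓ₂) where
  open StrictTotalOrder S using (irrefl; asym; module Eq)
  open Words S

  commute⇒¬primitive : ∀ {x y} → x ≢ [] → y ≢ [] → x ++ y ≡ y ++ x → ¬ Primitive (x ++ y)
  commute⇒¬primitive {x} {y} x≢[] y≢[] xy≡yx xy-primitive with commute⇒commonRoot xy≡yx
  ... | z , zero  , _     , x≡[] , _    = x≢[] x≡[]
  ... | z , suc _ , zero  , _    , y≡[] = y≢[] y≡[]
  ... | z , m@(suc _) , n@(suc _) , x≡zᵐ , y≡zⁿ =
        xy-primitive (z , m + n , +-mono-≤ (s≤s z≤n) (s≤s z≤n) ,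
                      trans (cong₂ _++_ x≡zᵐ y≡zⁿ) (sym (^-+ z m n)))

  ≺in-∷⁻ : ∀ {a b x y} → (a ∷ x) ≺in (b ∷ y) → a <in b ⊎ (a ≡ b × x ≺in y)
  ≺in-∷⁻ (inj₁ (z , z≢[] , eq)) with ∷-injective eq
  ... | refl , eq′ = inj₂ (refl , inj₁ (z , z≢[] , eq′))
  ≺in-∷⁻ (inj₂ ([] , _ , _ , _ , _ , refl , refl , a<b)) = inj₁ a<b
  ≺in-∷⁻ (inj₂ (_ ∷ r , a , s , b , t , refl , refl , a<b)) =
    inj₂ (refl , inj₂ (r , a , s , b , t , refl , refl , a<b))

  ≺in-∷⁺ : ∀ {a x y} → x ≺in y → (a ∷ x) ≺in (a ∷ y)
  ≺in-∷⁺ {a} (inj₁ (z , z≢[] , eq)) = inj₁ (z , z≢[] , cong (a ∷_) eq)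
  ≺in-∷⁺ {a} (inj₂ (r , a′ , s , b , t , refl , refl , a′<b)) =
    inj₂ (a ∷ r , a′ , s , b , t , refl , refl , a′<b)

  ⊀in-[] : ∀ {x} → ¬ (x ≺in [])
  ⊀in-[] {x} (inj₁ (z , z≢[] , x++z≡[])) = z≢[] (++-conicalʳ x z x++z≡[])
  ⊀in-[] (inj₂ (r , _ , _ , b , t , _ , r++bt≡[] , _)) with ++-conicalʳ r (b ∷ t) (sym r++bt≡[])
  ... | ()

  ≺in-asym : ∀ {x y} → x ≺in y → ¬ (y ≺in x)
  ≺in-asym {[]}             x≺y y≺x = ⊀in-[] y≺x
  ≺in-asym {_ ∷ _} {[]}     x≺y y≺x = ⊀in-[] x≺y
  ≺in-asym {_ ∷ _} {_ ∷ _} x≺y y≺x with ≺in-∷⁻ x≺y | ≺in-∷⁻ y≺x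
  ... | inj₁ a<b            | inj₁ b<a          = asym a<b b<a
  ... | inj₁ a<a            | inj₂ (refl , _)   = irrefl Eq.refl a<a
  ... | inj₂ (refl , _)     | inj₁ a<a          = irrefl Eq.refl a<a
  ... | inj₂ (refl , x′≺y′) | inj₂ (_ , y′≺x′) = ≺in-asym x′≺y′ y′≺x′

  ≺in-cancelˡ : ∀ r {x y} → (r ++ x) ≺in (r ++ y) → x ≺in y
  ≺in-cancelˡ []      x≺y = x≺y
  ≺in-cancelˡ (_ ∷ r) rx≺ry with ≺in-∷⁻ rx≺ry
  ... | inj₁ a<a          = ⊥-elim (irrefl Eq.refl a<a)
  ... | inj₂ (_ , rx≺ry′) = ≺in-cancelˡ r rx≺ry′

  ≺in-++-equalLength : ∀ x y {u v} → length x ≡ length y → (x ++ u) ≺in (y ++ v) → x ≺in y ⊎ x ≡ y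
  ≺in-++-equalLength []      []      _  _ = inj₂ refl
  ≺in-++-equalLength (a ∷ x) (b ∷ y) |x|≡|y| xu≺yv with ≺in-∷⁻ xu≺yv
  ... | inj₁ a<b = inj₁ (inj₂ ([] , a , x , b , y , refl , refl , a<b))
  ... | inj₂ (refl , xu≺yv′) with ≺in-++-equalLength x y (suc-injective |x|≡|y|) xu≺yv′
  ...   | inj₁ x≺y = inj₁ (≺in-∷⁺ x≺y)
  ...   | inj₂ x≡y = inj₂ (cong (a ∷_) x≡y)

  antiLyndon-unbordered : ∀ {p b} → AntiLyndon (p ++ b) → p ≢ [] → b ≢ [] → ¬ (p ++ b) ≥p b
  antiLyndon-unbordered {p} {b} (_ , pb-primitive , minimal) p≢[] b≢[] (t , bt≡pb) =
    [ ≺in-asym t≺p , p≢t ] p≼t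
    where
    open ≡-Reasoning

    p≢t : p ≢ t
    p≢t refl = commute⇒¬primitive p≢[] b≢[] (sym bt≡pb) pb-primitive

    t≺p : t ≺in p
    t≺p = ≺in-cancelˡ b (subst (_≺in (b ++ p)) (sym bt≡pb)
            (minimal (b ++ p) (p , b , refl , refl)
              (λ bp≡pb → p≢t (++-cancelˡ b p t (trans bp≡pb (sym bt≡pb))))))

    |p|≡|t| : length p ≡ length t
    |p|≡|t| = +-cancelˡ-≡ (length b) (length p) (length t) (begin
      length b + length p ≡⟨ +-comm (length b) (length p) ⟩
      length p + length b ≡⟨ length-++ p ⟨
      length (p ++ b)     ≡⟨ cong length bt≡pb ⟨
      length (b ++ t)     ≡⟨ length-++ b ⟩
      length b + length t ∎)

    p≼t : p ≺in t ⊎ p ≡ t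
    p≼t = ≺in-++-equalLength p t |p|≡|t|
            (minimal (t ++ b) (b , t , sym bt≡pb , refl)
              (λ tb≡pb → p≢t (sym (++-cancelʳ b t p tb≡pb))))

  ≥p-refl : ∀ {x} → x ≥p x
  ≥p-refl {x} = [] , ++-identityʳ x

  ≥p-trans : ∀ {x y z} → x ≥p y → y ≥p z → x ≥p z
  ≥p-trans {z = z} (u , yu≡x) (v , zv≡y) =
    v ++ u , trans (sym (++-assoc z v u)) (trans (cong (_++ u) zv≡y) yu≡x)

  ≥p∧≢⇒length< : ∀ {x y} → x ≥p y → y ≢ x → length y < length x
  ≥p∧≢⇒length< {y = y} ([] , y[]≡x) y≢x = ⊥-elim (y≢x (trans (sym (++-identityʳ y)) y[]≡x))
  ≥p∧≢⇒length< {y = y} (_ ∷ _ , refl) _ =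
    subst (length y <_) (sym (length-++ y)) (m<m+n (length y) (s≤s z≤n))

  ≥p-chain : ∀ {h} (l : ℕ → Word) → (∀ k → 1 ≤ k → k < h → l k ≥p l (suc k)) →
             ∀ {k m} → 1 ≤ k → k ≤′ m → m ≤ h → l k ≥p l m
  ≥p-chain l step 1≤k ≤′-refl               _   = ≥p-refl
  ≥p-chain l step 1≤k (≤′-step {m} k≤′m) m<h =
    ≥p-trans (≥p-chain l step 1≤k k≤′m (<⇒≤ m<h)) (step m (≤-trans 1≤k (≤′⇒≤ k≤′m)) m<h)

  prodFrom-snoc : ∀ (l : ℕ → Word) i n → prodFrom l i (suc n) ≡ prodFrom l i n ++ l (i + suc n)
  prodFrom-snoc l i zero = trans (++-identityʳ (l (suc i))) (cong l (+-comm 1 i))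
  prodFrom-snoc l i (suc n) = begin
    l (suc i) ++ prodFrom l (suc i) (suc n)                   ≡⟨ cong (l (suc i) ++_) (prodFrom-snoc l (suc i) n) ⟩
    l (suc i) ++ (prodFrom l (suc i) n ++ l (suc i + suc n))  ≡⟨ ++-assoc (l (suc i)) _ _ ⟨
    prodFrom l i (suc n) ++ l (suc (i + suc n))               ≡⟨ cong (λ m → prodFrom l i (suc n) ++ l m) (+-suc i (suc n)) ⟨
    prodFrom l i (suc n) ++ l (i + suc (suc n))               ∎
    where open ≡-Reasoning

  prodFrom≢l₁ : ∀ {h} (l : ℕ → Word) →
    (∀ k → 1 ≤ k → k ≤ h → AntiLyndon (l k)) →
    (∀ k → 1 ≤ k → k < h → l k ≥p l (suc k)) →
    ∀ {i} → 1 ≤ i → l i ≡ l 1 → l i ≢ l (suc i) →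
    ∀ k → 1 ≤ k → i + k ≤ h → prodFrom l i k ≢ l 1
  prodFrom≢l₁ l _ _ _ ℓᵢ≡ℓ₁ ℓᵢ≢ℓᵢ₊₁ (suc zero) _ _ ℓᵢ₊₁[]≡ℓ₁ =
    ℓᵢ≢ℓᵢ₊₁ (trans ℓᵢ≡ℓ₁ (sym (trans (sym (++-identityʳ _)) ℓᵢ₊₁[]≡ℓ₁)))
  prodFrom≢l₁ {h} l antiLyndon step {i} 1≤i ℓᵢ≡ℓ₁ _ (suc (suc o)) _ i+k≤h P≡ℓ₁ =
    antiLyndon-unbordered (subst AntiLyndon ℓ₁≡Qℓₘ (antiLyndon 1 ≤-refl 1≤h)) Q≢[] ℓₘ≢[]
      (subst (_≥p l m) ℓ₁≡Qℓₘ ℓ₁≥pℓₘ)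
    where
    m : ℕ
    m = i + suc (suc o)

    i<m : i < m
    i<m = m<m+n i (s≤s z≤n)

    1≤h : 1 ≤ h
    1≤h = ≤-trans 1≤i (≤-trans (<⇒≤ i<m) i+k≤h)

    ℓ₁≡Qℓₘ : l 1 ≡ prodFrom l i (suc o) ++ l m
    ℓ₁≡Qℓₘ = trans (sym P≡ℓ₁) (prodFrom-snoc l i (suc o))

    Q≢[] : prodFrom l i (suc o) ≢ []
    Q≢[] Q≡[] = proj₁ (antiLyndon (suc i) (s≤s z≤n) (≤-trans i<m i+k≤h)) (++-conicalˡ _ _ Q≡[])

    ℓₘ≢[] : l m ≢ []
    ℓₘ≢[] = proj₁ (antiLyndon m (≤-trans 1≤i (<⇒≤ i<m)) i+k≤h)

    ℓ₁≥pℓₘ : l 1 ≥p l m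
    ℓ₁≥pℓₘ = subst (_≥p l m) ℓᵢ≡ℓ₁ (≥p-chain l step 1≤i (≤⇒≤′ (<⇒≤ i<m)) i+k≤h)

proposition9p4 : ∀ {c ℓ₁ ℓ₂ : Level} (S : StrictTotalOrder c ℓ₁ ℓ₂) → Finite (StrictTotalOrder.Carrier S) →
    let open Words S in
    (h : ℕ) (l : ℕ → Word) →
    (∀ k → 1 ≤ k → k ≤ h → AntiLyndon (l k)) →
    (∀ k → 1 ≤ k → k < h → l k ≥p l (suc k)) →
    2 ≤ h →
    (i : ℕ) → 1 ≤ i → i < h →
    (∀ k → 1 ≤ k → k ≤ i → l k ≡ l 1) →
    l i ≢ l (suc i) →
    (j : ℕ) → i < j → j ≤ h →
    l 1 ≥p prodW l i j →
    length (prodW l i j) < length (l 1)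
proposition9p4 S _ h l antiLyndon step _ i 1≤i _ ℓₖ≡ℓ₁ ℓᵢ≢ℓᵢ₊₁ j i<j j≤h ℓ₁≥pP =
  ≥p∧≢⇒length< ℓ₁≥pP
    (prodFrom≢l₁ l antiLyndon step 1≤i (ℓₖ≡ℓ₁ i 1≤i ≤-refl) ℓᵢ≢ℓᵢ₊₁ (j ∸ i) (m<n⇒0<n∸m i<j) i+[j∸i]≤h)
  where
  open AntiLyndonWords S

  i+[j∸i]≤h : i + (j ∸ i) ≤ h
  i+[j∸i]≤h = subst (_≤ h) (sym (m+[n∸m]≡n (<⇒≤ i<j))) j≤h
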